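{- Let $A,B$ be non-empty sets, $I$ a non-empty index set, $\{V_i\}_{i\in I}\subseteq\mathcal{R}(A)$, $\{W_i\}_{i\in I}\subseteq\mathcal{R}(B)$, $\mathcal{A}=(A,I,V_i)$, $\mathcal{B}=(B,I,W_i)$. Let $R\in\mathcal{R}(A,B)$ be a uniform fuzzy relation and $Z\in\mathcal{R}(A,B)$ a fuzzy relation with $R\le Z$. Then $R$ is a solution to $WL^{2\text{ - }3}(A,B,I,V_i,W_i,Z)$ if and only if all of the following hold: (i) $E_A^R$ is a solution to $WL^{1\text{ - }4}(A,I,V_i,Z\circ Z^{ -1})$; (ii) $E_B^R$ is a solution to $WL^{1\text{ - }4}(B,I,W_i,Z^{ -1}\circ Z)$; (iii) $\widetilde R$ is an isomorphism of the quotient fuzzy relational systems $\mathcal{A}/E_A^R$ and $\mathcal{B}/E_B^R$.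
   Context: $\mathcal{L}=(L,\wedge,\vee,\otimes,\to,0,1)$ is a complete residuated lattice; $x\leftrightarrow y=(x\to y)\wedge(y\to x)$. $\mathcal{R}(X,Y)$: fuzzy relations $X\times Y\to L$ ordered pointwise, $\mathcal{R}(X)=\mathcal{R}(X,X)$; $R^{ -1}(y,x)=R(x,y)$; $(R\circ S)(x,z)=\bigvee_y R(x,y)\otimes S(y,z)$. Kernel and co-kernel of $R\in\mathcal{R}(A,B)$: $E_A^R(a_1,a_2)=\bigwedge_{b}(R(a_1,b)\leftrightarrow R(a_2,b))$, $E_B^R(b_1,b_2)=\bigwedge_a(R(a,b_1)\leftrightarrow R(a,b_2))$ (fuzzy equivalences). $R$ is a partial fuzzy function if $R(a_1,b)\otimes E_A^R(a_1,a_2)\le R(a_2,b)$, $R(a,b_1)\otimes E_B^R(b_1,b_2)\le R(a,b_2)$ and $R(a,b_1)\otimes R(a,b_2)\le E_B^R(b_1,b_2)$; it is a uniform fuzzy relation if moreover each $a$ has some $b$ with $R(a,b)=1$ and each $b$ has some $a$ with $R(a,b)=1$. For a fuzzy equivalence $E$ on $X$, $E_x(y)=E(x,y)$ and $X/E=\{E_x:x\in X\}$. For uniform $R$ with $E=E_A^R$, $F=E_B^R$, the map $\widetilde R:A/E\to B/F$ is $\widetilde R(E_a)=F_{\psi(a)}$, where $\psi:A\to B$ is any function with $R(a,\psi(a))=1$ for all $a$ (this is well defined, independent of $\psi$, and bijective). A fuzzy relational system is $(X,I,T_i)$ with $T_i\in\mathcal{R}(X)$; its quotient by a fuzzy equivalence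 $E$ is $(X/E,I,T_i^{X/E})$ with $T_i^{X/E}(E_{x_1},E_{x_2})=(E\circ T_i\circ E)(x_1,x_2)$. Systems $(X,I,T_i)$ and $(Y,I,S_i)$ are isomorphic via a bijection $\varphi:X\to Y$ if $T_i(x_1,x_2)=S_i(\varphi(x_1),\varphi(x_2))$ for all $x_1,x_2,i$. $WL^{2\text{ - }3}(A,B,I,V_i,W_i,Z)$ (unknown $U\in\mathcal{R}(A,B)$): $U^{ -1}\circ V_i\le W_i\circ U^{ -1}$, $U\circ W_i\le V_i\circ U$ ($i\in I$), $U\le Z$. $WL^{1\text{ - }4}(X,I,T_i,W)$ (unknown $U\in\mathcal{R}(X)$): $U\circ T_i\le T_i\circ U$, $U^{ -1}\circ T_i\le T_i\circ U^{ -1}$ ($i\in I$), $U\le W$, $U^{ -1}\le W$. -}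

module Defs where

open import Level using (Level; _⊔_) renaming (suc to lsuc)
open import Data.Product using (Σ; _×_; _,_; proj₁; proj₂)
open import Relation.Binary.PropositionalEquality using (_≡_; refl)

-- A complete residuated lattice (L, ∧, ∨, ⊗, ⇒, 0, 1).
-- Carrier equality is propositional equality; arbitrary joins/meets are
-- taken over index types in the universe Set ℓ.
record CRL (c ℓ : Level) : Set (lsuc (c ⊔ ℓ)) where
  infixr 7 _⊗_
  infixr 6 _∧_
  infixr 5 _∨_
  infixr 4 _⇒_
  infix 3 _≤_
  field
    Carrier   : Set c
    _≤_       : Carrier → Carrier → Set c
    ≤-refl    : ∀ {x} → x ≤ x
    ≤-trans   : ∀ {x y z} → x ≤ y → y ≤ z → x ≤ z
    ≤-antisym : ∀ {x y} → x ≤ y → y ≤ x → x ≡ y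
    _∧_ _∨_ _⊗_ _⇒_ : Carrier → Carrier → Carrier
    0L 1L     : Carrier
    ⋁ ⋀       : {J : Set ℓ} → (J → Carrier) → Carrier
    ∧-lb₁  : ∀ {x y} → x ∧ y ≤ x
    ∧-lb₂  : ∀ {x y} → x ∧ y ≤ y
    ∧-glb  : ∀ {x y z} → z ≤ x → z ≤ y → z ≤ x ∧ y
    ∨-ub₁  : ∀ {x y} → x ≤ x ∨ y
    ∨-ub₂  : ∀ {x y} → y ≤ x ∨ y
    ∨-lub  : ∀ {x y z} → x ≤ z → y ≤ z → x ∨ y ≤ z
    0-min  : ∀ {x} → 0L ≤ x
    1-max  : ∀ {x} → x ≤ 1L
    ⋁-ub   : ∀ {J : Set ℓ} (f : J → Carrier) (j : J) → f j ≤ ⋁ f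
    ⋁-lub  : ∀ {J : Set ℓ} (f : J → Carrier) {z} → (∀ j → f j ≤ z) → ⋁ f ≤ z
    ⋀-lb   : ∀ {J : Set ℓ} (f : J → Carrier) (j : J) → ⋀ f ≤ f j
    ⋀-glb  : ∀ {J : Set ℓ} (f : J → Carrier) {z} → (∀ j → z ≤ f j) → z ≤ ⋀ f
    ⊗-assoc    : ∀ x y z → (x ⊗ y) ⊗ z ≡ x ⊗ (y ⊗ z)
    ⊗-comm     : ∀ x y → x ⊗ y ≡ y ⊗ x
    ⊗-identity : ∀ x → 1L ⊗ x ≡ x
    residual₁ : ∀ {x y z} → x ⊗ y ≤ z → x ≤ y ⇒ z
    residual₂ : ∀ {x y z} → x ≤ y ⇒ z → x ⊗ y ≤ z

module FuzzyRel {c ℓ : Level} (L : CRL c ℓ) where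
  open CRL L public

  infix 4 _⇔L_
  _⇔L_ : Carrier → Carrier → Carrier
  x ⇔L y = (x ⇒ y) ∧ (y ⇒ x)

  FRel : Set ℓ → Set ℓ → Set (c ⊔ ℓ)
  FRel X Y = X → Y → Carrier

  infix 3 _⊆_
  _⊆_ : {X Y : Set ℓ} → FRel X Y → FRel X Y → Set (c ⊔ ℓ)
  R ⊆ S = ∀ x y → R x y ≤ S x y

  _⁻¹ : {X Y : Set ℓ} → FRel X Y → FRel Y X
  (R ⁻¹) y x = R x y

  infixl 6 _⨾_
  _⨾_ : {X Y Z : Set ℓ} → FRel X Y → FRel Y Z → FRel X Z
  (R ⨾ S) x z = ⋁ (λ y → R x y ⊗ S y z)

  kerA : {A B : Set ℓ} → FRel A B → FRel A A
  kerA R a₁ a₂ = ⋀ (λ b → R a₁ b ⇔L R a₂ b)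

  kerB : {A B : Set ℓ} → FRel A B → FRel B B
  kerB R b₁ b₂ = ⋀ (λ a → R a b₁ ⇔L R a b₂)

  record IsPartialFuzzyFunction {A B : Set ℓ} (R : FRel A B) : Set (c ⊔ ℓ) where
    field
      extA : ∀ a₁ a₂ b → R a₁ b ⊗ kerA R a₁ a₂ ≤ R a₂ b
      extB : ∀ a b₁ b₂ → R a b₁ ⊗ kerB R b₁ b₂ ≤ R a b₂
      func : ∀ a b₁ b₂ → R a b₁ ⊗ R a b₂ ≤ kerB R b₁ b₂

  record IsUniform {A B : Set ℓ} (R : FRel A B) : Set (c ⊔ ℓ) where
    field
      partial : IsPartialFuzzyFunction R
      total   : ∀ a → Σ B (λ b → R a b ≡ 1L)
      onto    : ∀ b → Σ A (λ a → R a b ≡ 1L)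

  -- Equivalence classes E_x, as elements of X/E: a function f : X → L
  -- together with a representative x such that f = E_x (pointwise).
  Class : {X : Set ℓ} → FRel X X → Set (c ⊔ ℓ)
  Class {X} E = Σ (X → Carrier) (λ f → Σ X (λ x → ∀ y → f y ≡ E x y))

  [_]_ : {X : Set ℓ} (E : FRel X X) → X → Class E
  [ E ] x = E x , x , (λ _ → refl)

  ClassEq : {X : Set ℓ} (E : FRel X X) → Class E → Class E → Set (c ⊔ ℓ)
  ClassEq E (f , _) (g , _) = ∀ y → f y ≡ g y

  rep : {X : Set ℓ} {E : FRel X X} → Class E → X
  rep (_ , x , _) = x

  quotRel : {X : Set ℓ} (E : FRel X X) → FRel X X → Class E → Class E → Carrier
  quotRel E T C₁ C₂ = (E ⨾ T ⨾ E) (rep C₁) (rep C₂)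

  record IsQuotIso {X Y I : Set ℓ} (E : FRel X X) (F : FRel Y Y)
                   (T : I → FRel X X) (S : I → FRel Y Y)
                   (φ : Class E → Class F) : Set (c ⊔ ℓ) where
    field
      wellDefined : ∀ C₁ C₂ → ClassEq E C₁ C₂ → ClassEq F (φ C₁) (φ C₂)
      injective   : ∀ C₁ C₂ → ClassEq F (φ C₁) (φ C₂) → ClassEq E C₁ C₂
      surjective  : ∀ D → Σ (Class E) (λ C → ClassEq F (φ C) D)
      preserves   : ∀ i C₁ C₂ → quotRel E (T i) C₁ C₂ ≡ quotRel F (S i) (φ C₁) (φ C₂)

  -- R̃ : A/E_A^R → B/E_B^R,  R̃(E_a) = F_{ψ(a)} with ψ(a) chosen so that R(a, ψ a) = 1
  R~ : {A B : Set ℓ} (R : FRel A B) → IsUniform R → Class (kerA R) → Class (kerB R)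
  R~ R u C = [ kerB R ] proj₁ (IsUniform.total u (rep C))

  WL23 : {A B I : Set ℓ} → (I → FRel A A) → (I → FRel B B) → FRel A B → FRel A B → Set (c ⊔ ℓ)
  WL23 V W Z U = (∀ i → (U ⁻¹ ⨾ V i) ⊆ (W i ⨾ U ⁻¹))
               × (∀ i → (U ⨾ W i) ⊆ (V i ⨾ U))
               × (U ⊆ Z)

  WL14 : {X I : Set ℓ} → (I → FRel X X) → FRel X X → FRel X X → Set (c ⊔ ℓ)
  WL14 T W U = (∀ i → (U ⨾ T i) ⊆ (T i ⨾ U))
             × (∀ i → (U ⁻¹ ⨾ T i) ⊆ (T i ⨾ U ⁻¹))
             × (U ⊆ W)
             × (U ⁻¹ ⊆ W)

module Submission where

-- A uniform R satisfies R ⨾ R⁻¹ = E,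
-- R⁻¹ ⨾ R = F, E ⨾ R = R = R ⨾ F, and R(a, b) = F(ψ a, b) for any
-- ψ with R(a, ψ a) = 1.  The last identity gives the conjugation formula
-- (R ⨾ Q ⨾ R⁻¹)(a₁, a₂) = (F ⨾ Q ⨾ F)(ψ a₁, ψ a₂), which turns
-- "R̃ preserves the quotient relations" into the relational equation
-- R⁻¹ ⨾ V ⨾ R = F ⨾ W ⨾ F.

open import Defs
open import Level using (Level; _⊔_)
open import Function.Base using (_∘_)
open import Function.Bundles using (_⇔_; mk⇔; module Equivalence)
open import Data.Product using (_×_; _,_; proj₁; proj₂)
open import Relation.Binary.PropositionalEquality
  using (_≡_; refl; sym; trans; isEquivalence; module ≡-Reasoning)
open import Relation.Binary.Bundles using (Poset)
import Relation.Binary.Reasoning.PartialOrder as PartialOrderReasoning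

module FuzzyRelationCalculus {c ℓ : Level} (L : CRL c ℓ) where
  open FuzzyRel L public
  open Equivalence using (to; from)

  ≡⇒≤ : ∀ {x y} → x ≡ y → x ≤ y
  ≡⇒≤ refl = ≤-refl

  ≤-poset : Poset c c c
  ≤-poset = record
    { _≈_ = _≡_
    ; _≤_ = _≤_
    ; isPartialOrder = record
      { isPreorder = record { isEquivalence = isEquivalence ; reflexive = ≡⇒≤ ; trans = ≤-trans }
      ; antisym = ≤-antisym
      }
    }

  module ≤-Reasoning = PartialOrderReasoning ≤-poset

  -- Residuation makes ⊗ monotone in both arguments.
  ⊗-mono : ∀ {x x′ y y′} → x ≤ x′ → y ≤ y′ → x ⊗ y ≤ x′ ⊗ y′
  ⊗-mono {x} {x′} {y} {y′} p q = begin
    x ⊗ y    ≤⟨ ⊗-monoˡ p ⟩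
    x′ ⊗ y   ≡⟨ ⊗-comm x′ y ⟩
    y ⊗ x′   ≤⟨ ⊗-monoˡ q ⟩
    y′ ⊗ x′  ≡⟨ ⊗-comm y′ x′ ⟩
    x′ ⊗ y′  ∎
    where
      open ≤-Reasoning
      ⊗-monoˡ : ∀ {u u′ v} → u ≤ u′ → u ⊗ v ≤ u′ ⊗ v
      ⊗-monoˡ u≤u′ = residual₂ (≤-trans u≤u′ (residual₁ ≤-refl))

  ≤-⊗-one : ∀ {x y} → y ≡ 1L → x ≤ y ⊗ x
  ≤-⊗-one {x} refl = ≡⇒≤ (sym (⊗-identity x))

  ⋁-⊗ : ∀ {J : Set ℓ} (f : J → Carrier) t → ⋁ f ⊗ t ≤ ⋁ (λ j → f j ⊗ t)
  ⋁-⊗ f t = residual₂ (⋁-lub f (λ j → residual₁ (⋁-ub (λ j → f j ⊗ t) j)))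

  ⊗-⋁ : ∀ {J : Set ℓ} (f : J → Carrier) t → t ⊗ ⋁ f ≤ ⋁ (λ j → t ⊗ f j)
  ⊗-⋁ f t = begin
    t ⊗ ⋁ f                 ≡⟨ ⊗-comm t (⋁ f) ⟩
    ⋁ f ⊗ t                 ≤⟨ ⋁-⊗ f t ⟩
    ⋁ (λ j → f j ⊗ t)       ≤⟨ ⋁-lub _ (λ j → ≤-trans (≡⇒≤ (⊗-comm (f j) t)) (⋁-ub (λ j → t ⊗ f j) j)) ⟩
    ⋁ (λ j → t ⊗ f j)       ∎
    where open ≤-Reasoning

  ⇒-trans : ∀ {x y z} → (x ⇒ y) ⊗ (y ⇒ z) ≤ x ⇒ z
  ⇒-trans {x} {y} {z} = residual₁ (begin
    ((x ⇒ y) ⊗ (y ⇒ z)) ⊗ x  ≡⟨ cong-⊗ (⊗-comm (x ⇒ y) (y ⇒ z)) ⟩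
    ((y ⇒ z) ⊗ (x ⇒ y)) ⊗ x  ≡⟨ ⊗-assoc (y ⇒ z) (x ⇒ y) x ⟩
    (y ⇒ z) ⊗ ((x ⇒ y) ⊗ x)  ≤⟨ ⊗-mono ≤-refl (residual₂ ≤-refl) ⟩
    (y ⇒ z) ⊗ y              ≤⟨ residual₂ ≤-refl ⟩
    z                        ∎)
    where
      open ≤-Reasoning
      cong-⊗ : ∀ {u v} → u ≡ v → u ⊗ x ≡ v ⊗ x
      cong-⊗ refl = refl

  ⇔-refl : ∀ {x} → 1L ≤ x ⇔L x
  ⇔-refl {x} = ∧-glb 1≤x⇒x 1≤x⇒x
    where
      1≤x⇒x : 1L ≤ x ⇒ x
      1≤x⇒x = residual₁ (≡⇒≤ (⊗-identity x))

  ⇔-sym : ∀ {x y} → x ⇔L y ≤ y ⇔L x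
  ⇔-sym = ∧-glb ∧-lb₂ ∧-lb₁

  ⇔-trans : ∀ {x y z} → (x ⇔L y) ⊗ (y ⇔L z) ≤ x ⇔L z
  ⇔-trans {x} {y} {z} = ∧-glb
    (≤-trans (⊗-mono ∧-lb₁ ∧-lb₁) ⇒-trans)
    (≤-trans (≡⇒≤ (⊗-comm (x ⇔L y) (y ⇔L z))) (≤-trans (⊗-mono ∧-lb₂ ∧-lb₂) ⇒-trans))

  infix 3 _≋_
  _≋_ : {X Y : Set ℓ} → FRel X Y → FRel X Y → Set (c ⊔ ℓ)
  R ≋ S = R ⊆ S × S ⊆ R

  ⊆-refl : {X Y : Set ℓ} {R : FRel X Y} → R ⊆ R
  ⊆-refl x y = ≤-refl

  ⊆-trans : {X Y : Set ℓ} {R S T : FRel X Y} → R ⊆ S → S ⊆ T → R ⊆ T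
  ⊆-trans p q x y = ≤-trans (p x y) (q x y)

  ≋-refl : {X Y : Set ℓ} {R : FRel X Y} → R ≋ R
  ≋-refl = ⊆-refl , ⊆-refl

  ≋-sym : {X Y : Set ℓ} {R S : FRel X Y} → R ≋ S → S ≋ R
  ≋-sym (p , q) = q , p

  ≋-trans : {X Y : Set ℓ} {R S T : FRel X Y} → R ≋ S → S ≋ T → R ≋ T
  ≋-trans (p , q) (p′ , q′) = ⊆-trans p p′ , ⊆-trans q′ q

  ⊆-poset : (X Y : Set ℓ) → Poset (c ⊔ ℓ) (c ⊔ ℓ) (c ⊔ ℓ)
  ⊆-poset X Y = record
    { Carrier = FRel X Y
    ; _≈_ = _≋_
    ; _≤_ = _⊆_
    ; isPartialOrder = record
      { isPreorder = record
        { isEquivalence = record { refl = ≋-refl ; sym = ≋-sym ; trans = ≋-trans }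
        ; reflexive = proj₁
        ; trans = ⊆-trans
        }
      ; antisym = _,_
      }
    }

  module ⊆-Reasoning {X Y : Set ℓ} = PartialOrderReasoning (⊆-poset X Y)

  ≋⇒≡ : {X Y : Set ℓ} {R S : FRel X Y} → R ≋ S → ∀ x y → R x y ≡ S x y
  ≋⇒≡ (p , q) x y = ≤-antisym (p x y) (q x y)

  ≡⇒≋ : {X Y : Set ℓ} {R S : FRel X Y} → (∀ x y → R x y ≡ S x y) → R ≋ S
  ≡⇒≋ e = (λ x y → ≡⇒≤ (e x y)) , (λ x y → ≡⇒≤ (sym (e x y)))

  ⁻¹-cong : {X Y : Set ℓ} {R S : FRel X Y} → R ≋ S → R ⁻¹ ≋ S ⁻¹
  ⁻¹-cong (p , q) = (λ y x → p x y) , (λ y x → q x y)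

  ⨾-mono : {X Y Z : Set ℓ} {R R′ : FRel X Y} {S S′ : FRel Y Z} →
           R ⊆ R′ → S ⊆ S′ → R ⨾ S ⊆ R′ ⨾ S′
  ⨾-mono {R′ = R′} {S′ = S′} p q x z =
    ⋁-lub _ (λ y → ≤-trans (⊗-mono (p x y) (q y z)) (⋁-ub (λ y → R′ x y ⊗ S′ y z) y))

  ⨾-cong : {X Y Z : Set ℓ} {R R′ : FRel X Y} {S S′ : FRel Y Z} →
           R ≋ R′ → S ≋ S′ → R ⨾ S ≋ R′ ⨾ S′
  ⨾-cong (p , p′) (q , q′) = ⨾-mono p q , ⨾-mono p′ q′

  -- Composition is associative; both inclusions use that ⊗ distributes over ⋁.
  ⨾-assoc : {X Y Z U : Set ℓ} {R : FRel X Y} {S : FRel Y Z} {T : FRel Z U} →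
            R ⨾ S ⨾ T ≋ R ⨾ (S ⨾ T)
  ⨾-assoc {R = R} {S} {T} = left-to-right , right-to-left
    where
      left-to-right : R ⨾ S ⨾ T ⊆ R ⨾ (S ⨾ T)
      left-to-right x w = ⋁-lub _ λ z → ≤-trans (⋁-⊗ _ _) (⋁-lub _ λ y →
        ≤-trans (≡⇒≤ (⊗-assoc (R x y) (S y z) (T z w)))
        (≤-trans (⊗-mono ≤-refl (⋁-ub (λ z → S y z ⊗ T z w) z))
                 (⋁-ub (λ y → R x y ⊗ (S ⨾ T) y w) y)))
      right-to-left : R ⨾ (S ⨾ T) ⊆ R ⨾ S ⨾ T
      right-to-left x w = ⋁-lub _ λ y → ≤-trans (⊗-⋁ _ _) (⋁-lub _ λ z →
        ≤-trans (≡⇒≤ (sym (⊗-assoc (R x y) (S y z) (T z w))))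
        (≤-trans (⊗-mono (⋁-ub (λ y → R x y ⊗ S y z) y) ≤-refl)
                 (⋁-ub (λ z → (R ⨾ S) x z ⊗ T z w) z)))

  ⨾-cong-middle : {X Y Z U : Set ℓ} {P : FRel X Y} {Q Q′ : FRel Y Z} {T : FRel Z U} →
                  Q ≋ Q′ → P ⨾ Q ⨾ T ≋ P ⨾ Q′ ⨾ T
  ⨾-cong-middle e = ⨾-cong (⨾-cong ≋-refl e) ≋-refl

  ⨾-sandwich : {X Y Z U V W : Set ℓ}
               {P : FRel X Y} {Q : FRel Y Z} {M : FRel Z U} {Q′ : FRel U V} {P′ : FRel V W} →
               P ⨾ (Q ⨾ M ⨾ Q′) ⨾ P′ ≋ P ⨾ Q ⨾ M ⨾ (Q′ ⨾ P′)
  ⨾-sandwich {P = P} {Q} {M} {Q′} {P′} = begin-equality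
    P ⨾ (Q ⨾ M ⨾ Q′) ⨾ P′      ≈⟨ ⨾-cong (≋-sym ⨾-assoc) ≋-refl ⟩
    P ⨾ (Q ⨾ M) ⨾ Q′ ⨾ P′      ≈⟨ ⨾-cong (⨾-cong (≋-sym ⨾-assoc) ≋-refl) ≋-refl ⟩
    P ⨾ Q ⨾ M ⨾ Q′ ⨾ P′        ≈⟨ ⨾-assoc ⟩
    P ⨾ Q ⨾ M ⨾ (Q′ ⨾ P′)      ∎
    where open ⊆-Reasoning

  composite-commutes : {X Y : Set ℓ} {P : FRel X Y} {Q : FRel Y X} {V : FRel X X} {W : FRel Y Y} →
                       Q ⨾ V ⊆ W ⨾ Q → P ⨾ W ⊆ V ⨾ P → P ⨾ Q ⨾ V ⊆ V ⨾ (P ⨾ Q)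
  composite-commutes {P = P} {Q} {V} {W} QV⊆WQ PW⊆VP = begin
    P ⨾ Q ⨾ V        ≈⟨ ⨾-assoc ⟩
    P ⨾ (Q ⨾ V)      ≤⟨ ⨾-mono ⊆-refl QV⊆WQ ⟩
    P ⨾ (W ⨾ Q)      ≈⟨ ≋-sym ⨾-assoc ⟩
    P ⨾ W ⨾ Q        ≤⟨ ⨾-mono PW⊆VP ⊆-refl ⟩
    V ⨾ P ⨾ Q        ≈⟨ ⨾-assoc ⟩
    V ⨾ (P ⨾ Q)      ∎
    where open ⊆-Reasoning

  record IsFuzzyEquivalence {X : Set ℓ} (E : FRel X X) : Set (c ⊔ ℓ) where
    field
      reflexive  : ∀ x → 1L ≤ E x x
      symmetric  : E ⁻¹ ⊆ E
      transitive : E ⨾ E ⊆ E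

  -- The kernel of any fuzzy relation is a fuzzy equivalence; since
  -- kerB R is kerA (R ⁻¹), the same holds for co-kernels.
  kernel-isFuzzyEquivalence : {A B : Set ℓ} (R : FRel A B) → IsFuzzyEquivalence (kerA R)
  kernel-isFuzzyEquivalence R = record
    { reflexive  = λ a → ⋀-glb _ (λ b → ⇔-refl)
    ; symmetric  = λ a₁ a₂ → ⋀-glb _ (λ b → ≤-trans (⋀-lb _ b) ⇔-sym)
    ; transitive = λ a₁ a₃ → ⋁-lub _ λ a₂ → ⋀-glb _ λ b →
        ≤-trans (⊗-mono (⋀-lb _ b) (⋀-lb _ b)) ⇔-trans
    }

  module FuzzyEquivalence {X : Set ℓ} {E : FRel X X} (isEq : IsFuzzyEquivalence E) where
    open IsFuzzyEquivalence isEq public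

    ⊆⨾E : {Y : Set ℓ} {Q : FRel Y X} → Q ⊆ Q ⨾ E
    ⊆⨾E {Q = Q} y x = ≤-trans (≤-⊗-one refl) (≤-trans (≡⇒≤ (⊗-comm 1L (Q y x)))
                              (≤-trans (⊗-mono ≤-refl (reflexive x)) (⋁-ub (λ z → Q y z ⊗ E z x) x)))

    ⊆E⨾ : {Y : Set ℓ} {Q : FRel X Y} → Q ⊆ E ⨾ Q
    ⊆E⨾ {Q = Q} x y = ≤-trans (≤-⊗-one refl)
                              (≤-trans (⊗-mono (reflexive x) ≤-refl) (⋁-ub (λ z → E x z ⊗ Q z y) x))

    E⨾E≋E : E ⨾ E ≋ E
    E⨾E≋E = transitive , ⊆⨾E

    E⁻¹≋E : E ⁻¹ ≋ E
    E⁻¹≋E = symmetric , (λ x y → symmetric y x)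

    saturate-idem : {Q : FRel X X} → E ⨾ (E ⨾ Q ⨾ E) ⨾ E ≋ E ⨾ Q ⨾ E
    saturate-idem = ≋-trans ⨾-sandwich (⨾-cong (⨾-cong E⨾E≋E ≋-refl) E⨾E≋E)

    commuting⇒absorbs : {T : FRel X X} → E ⨾ T ⊆ T ⨾ E → E ⨾ T ⨾ E ⊆ T ⨾ E
    commuting⇒absorbs {T} ET⊆TE = begin
      E ⨾ T ⨾ E      ≤⟨ ⨾-mono ET⊆TE ⊆-refl ⟩
      T ⨾ E ⨾ E      ≈⟨ ⨾-assoc ⟩
      T ⨾ (E ⨾ E)    ≈⟨ ⨾-cong ≋-refl E⨾E≋E ⟩
      T ⨾ E          ∎
      where open ⊆-Reasoning

    commuting⇒WL14 : {I : Set ℓ} {T : I → FRel X X} {W : FRel X X} →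
                     (∀ i → E ⨾ T i ⊆ T i ⨾ E) → E ⊆ W → WL14 T W E
    commuting⇒WL14 ET⊆TE E⊆W =
        ET⊆TE
      , (λ i → ⊆-trans (⨾-mono symmetric ⊆-refl) (⊆-trans (ET⊆TE i) (⨾-mono ⊆-refl (proj₂ E⁻¹≋E))))
      , E⊆W
      , ⊆-trans symmetric E⊆W

    classEq⇔one : (C₁ C₂ : Class E) → ClassEq E C₁ C₂ ⇔ E (rep C₁) (rep C₂) ≡ 1L
    classEq⇔one (f , x , f≡Ex) (g , y , g≡Ey) = mk⇔ sameClass⇒one one⇒sameClass
      where
        sameClass⇒one : (∀ z → f z ≡ g z) → E x y ≡ 1L
        sameClass⇒one f≡g = ≤-antisym 1-max (begin
          1L      ≤⟨ reflexive y ⟩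
          E y y   ≡⟨ g≡Ey y ⟨
          g y     ≡⟨ f≡g y ⟨
          f y     ≡⟨ f≡Ex y ⟩
          E x y   ∎)
          where open ≤-Reasoning
        -- E y z = 1 ⊗ E y z = E x y ⊗ E y z ≤ E x z, and symmetrically.
        one⇒sameClass : E x y ≡ 1L → ∀ z → f z ≡ g z
        one⇒sameClass Exy≡1 z = trans (f≡Ex z) (trans (≤-antisym Exz≤Eyz Eyz≤Exz) (sym (g≡Ey z)))
          where
            Exz≤Eyz : E x z ≤ E y z
            Exz≤Eyz = ≤-trans (≤-⊗-one (trans (sym (≋⇒≡ E⁻¹≋E y x)) Exy≡1))
                              (≤-trans (⋁-ub (λ w → E y w ⊗ E w z) x) (transitive y z))
            Eyz≤Exz : E y z ≤ E x z
            Eyz≤Exz = ≤-trans (≤-⊗-one Exy≡1)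
                              (≤-trans (⋁-ub (λ w → E x w ⊗ E w z) y) (transitive x z))

  module Uniform {A B : Set ℓ} (R : FRel A B) (uniform : IsUniform R) where
    open IsUniform uniform
    open IsPartialFuzzyFunction partial

    E : FRel A A
    E = kerA R

    F : FRel B B
    F = kerB R

    module E = FuzzyEquivalence (kernel-isFuzzyEquivalence R)
    module F = FuzzyEquivalence (kernel-isFuzzyEquivalence (R ⁻¹))

    ψ : A → B
    ψ a = proj₁ (total a)

    -- The kernel is R ⨾ R⁻¹: ⊆ by functionality, ⊇ through ψ.
    R⨾R⁻¹≋E : R ⨾ R ⁻¹ ≋ E
    R⨾R⁻¹≋E = R⨾R⁻¹⊆E , E⊆R⨾R⁻¹
      where
        -- R(a₁,b) ⊗ R(a₂,b) ⊗ R(a₁,b') ≤ R(a₂,b') by functionality and extensionality.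
        transport : ∀ a₁ a₂ b b′ → (R a₁ b ⊗ R a₂ b) ⊗ R a₁ b′ ≤ R a₂ b′
        transport a₁ a₂ b b′ = begin
          (R a₁ b ⊗ R a₂ b) ⊗ R a₁ b′  ≡⟨ ⊗-assoc (R a₁ b) (R a₂ b) (R a₁ b′) ⟩
          R a₁ b ⊗ (R a₂ b ⊗ R a₁ b′)  ≡⟨ ⊗-comm (R a₁ b) _ ⟩
          (R a₂ b ⊗ R a₁ b′) ⊗ R a₁ b  ≡⟨ ⊗-assoc (R a₂ b) (R a₁ b′) (R a₁ b) ⟩
          R a₂ b ⊗ (R a₁ b′ ⊗ R a₁ b)  ≤⟨ ⊗-mono ≤-refl (func a₁ b′ b) ⟩
          R a₂ b ⊗ F b′ b              ≤⟨ ⊗-mono ≤-refl (F.symmetric b b′) ⟩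
          R a₂ b ⊗ F b b′              ≤⟨ extB a₂ b b′ ⟩
          R a₂ b′                      ∎
          where open ≤-Reasoning
        R⨾R⁻¹⊆E : R ⨾ R ⁻¹ ⊆ E
        R⨾R⁻¹⊆E a₁ a₂ = ⋁-lub _ λ b → ⋀-glb _ λ b′ → ∧-glb
          (residual₁ (transport a₁ a₂ b b′))
          (residual₁ (≤-trans (⊗-mono (≡⇒≤ (⊗-comm (R a₁ b) (R a₂ b))) ≤-refl) (transport a₂ a₁ b b′)))
        E⊆R⨾R⁻¹ : E ⊆ R ⨾ R ⁻¹
        E⊆R⨾R⁻¹ a₁ a₂ = ≤-trans (≤-⊗-one (proj₂ (total a₁)))
          (≤-trans (⊗-mono ≤-refl (≤-trans (≤-⊗-one (proj₂ (total a₁))) (extA a₁ a₂ (ψ a₁))))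
                   (⋁-ub (λ b → R a₁ b ⊗ R a₂ b) (ψ a₁)))

    -- The co-kernel is R⁻¹ ⨾ R: ⊆ by functionality, ⊇ through surjectivity.
    R⁻¹⨾R≋F : R ⁻¹ ⨾ R ≋ F
    R⁻¹⨾R≋F = (λ b₁ b₂ → ⋁-lub _ λ a → func a b₁ b₂) , F⊆R⁻¹⨾R
      where
        F⊆R⁻¹⨾R : F ⊆ R ⁻¹ ⨾ R
        F⊆R⁻¹⨾R b₁ b₂ = ≤-trans (≤-⊗-one (proj₂ (onto b₁)))
          (≤-trans (⊗-mono ≤-refl (≤-trans (≤-⊗-one (proj₂ (onto b₁))) (extB (proj₁ (onto b₁)) b₁ b₂)))
                   (⋁-ub (λ a → R a b₁ ⊗ R a b₂) (proj₁ (onto b₁))))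

    E⨾R≋R : E ⨾ R ≋ R
    E⨾R≋R = (λ a b → ⋁-lub _ λ a′ →
               ≤-trans (≡⇒≤ (⊗-comm (E a a′) (R a′ b)))
                       (≤-trans (⊗-mono ≤-refl (E.symmetric a′ a)) (extA a′ a b)))
          , E.⊆E⨾

    R⨾F≋R : R ⨾ F ≋ R
    R⨾F≋R = (λ a b → ⋁-lub _ λ b′ → extB a b′ b) , F.⊆⨾E

    F⨾R⁻¹≋R⁻¹ : F ⨾ R ⁻¹ ≋ R ⁻¹
    F⨾R⁻¹≋R⁻¹ = (λ b a → ⋁-lub _ λ b′ →
                   ≤-trans (≡⇒≤ (⊗-comm (F b b′) (R a b′)))
                           (≤-trans (⊗-mono ≤-refl (F.symmetric b′ b)) (extB a b′ b)))
              , F.⊆E⨾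

    R-via-ψ : ∀ a b → R a b ≡ F (ψ a) b
    R-via-ψ a b = ≤-antisym
      (≤-trans (≤-⊗-one (proj₂ (total a))) (func a (ψ a) b))
      (≤-trans (≤-⊗-one (proj₂ (total a))) (extB a (ψ a) b))

    conjugate : (Q : FRel B B) → ∀ a₁ a₂ → (R ⨾ Q ⨾ R ⁻¹) a₁ a₂ ≡ (F ⨾ Q ⨾ F) (ψ a₁) (ψ a₂)
    conjugate Q a₁ a₂ = begin
      (R ⨾ Q ⨾ R ⁻¹) a₁ a₂          ≡⟨ ≋⇒≡ R⨾Q⨾R⁻¹≋Fψ⨾Q⨾Fψ⁻¹ a₁ a₂ ⟩
      (Fψ ⨾ Q ⨾ Fψ ⁻¹) a₁ a₂        ≡⟨⟩
      (F ⨾ Q ⨾ F ⁻¹) (ψ a₁) (ψ a₂)  ≡⟨ ≋⇒≡ (⨾-cong {R = F ⨾ Q} ≋-refl F.E⁻¹≋E) (ψ a₁) (ψ a₂) ⟩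
      (F ⨾ Q ⨾ F) (ψ a₁) (ψ a₂)     ∎
      where
        open ≡-Reasoning
        Fψ : FRel A B
        Fψ a b = F (ψ a) b
        R≋Fψ : R ≋ Fψ
        R≋Fψ = ≡⇒≋ R-via-ψ
        R⨾Q⨾R⁻¹≋Fψ⨾Q⨾Fψ⁻¹ : R ⨾ Q ⨾ R ⁻¹ ≋ Fψ ⨾ Q ⨾ Fψ ⁻¹
        R⨾Q⨾R⁻¹≋Fψ⨾Q⨾Fψ⁻¹ = ⨾-cong (⨾-cong R≋Fψ ≋-refl) (⁻¹-cong R≋Fψ)

    E-via-ψ : ∀ a₁ a₂ → E a₁ a₂ ≡ F (ψ a₁) (ψ a₂)
    E-via-ψ a₁ a₂ = begin
      E a₁ a₂                    ≡⟨ ≋⇒≡ E≋R⨾F⨾R⁻¹ a₁ a₂ ⟩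
      (R ⨾ F ⨾ R ⁻¹) a₁ a₂       ≡⟨ conjugate F a₁ a₂ ⟩
      (F ⨾ F ⨾ F) (ψ a₁) (ψ a₂)  ≡⟨ ≋⇒≡ (≋-trans (⨾-cong F.E⨾E≋E ≋-refl) F.E⨾E≋E) (ψ a₁) (ψ a₂) ⟩
      F (ψ a₁) (ψ a₂)            ∎
      where
        open ≡-Reasoning
        E≋R⨾F⨾R⁻¹ : E ≋ R ⨾ F ⨾ R ⁻¹
        E≋R⨾F⨾R⁻¹ = ≋-sym (≋-trans (⨾-cong R⨾F≋R ≋-refl) R⨾R⁻¹≋E)

    R̃ : Class E → Class F
    R̃ = R~ R uniform

    -- R̃ is a bijection A/E → B/F (by E-via-ψ and surjectivity of R); it is
    -- an isomorphism as soon as the quotient relations agree along ψ.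
    R~-isQuotIso : {I : Set ℓ} (V : I → FRel A A) (W : I → FRel B B) →
                   (∀ i a₁ a₂ → (E ⨾ V i ⨾ E) a₁ a₂ ≡ (F ⨾ W i ⨾ F) (ψ a₁) (ψ a₂)) →
                   IsQuotIso E F V W R̃
    R~-isQuotIso V W preserves = record
      { wellDefined = λ C₁ C₂ → from (F.classEq⇔one (R̃ C₁) (R̃ C₂))
                                ∘ trans (sym (E-via-ψ (rep C₁) (rep C₂))) ∘ to (E.classEq⇔one C₁ C₂)
      ; injective   = λ C₁ C₂ → from (E.classEq⇔one C₁ C₂)
                                ∘ trans (E-via-ψ (rep C₁) (rep C₂)) ∘ to (F.classEq⇔one (R̃ C₁) (R̃ C₂))
      ; surjective  = λ D → let a = proj₁ (onto (rep D)) in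
                          [ E ] a , from (F.classEq⇔one (R̃ ([ E ] a)) D)
                                         (trans (sym (R-via-ψ a (rep D))) (proj₂ (onto (rep D))))
      ; preserves   = λ i C₁ C₂ → preserves i (rep C₁) (rep C₂)
      }

    F-sandwich : {Q : FRel B B} → R ⁻¹ ⨾ (R ⨾ Q ⨾ R ⁻¹) ⨾ R ≋ F ⨾ Q ⨾ F
    F-sandwich = ≋-trans ⨾-sandwich (⨾-cong (⨾-cong R⁻¹⨾R≋F ≋-refl) R⁻¹⨾R≋F)

    E-sandwich : {Y : FRel A A} → R ⨾ (R ⁻¹ ⨾ Y ⨾ R) ⨾ R ⁻¹ ≋ E ⨾ Y ⨾ E
    E-sandwich = ≋-trans ⨾-sandwich (⨾-cong (⨾-cong R⨾R⁻¹≋E ≋-refl) R⨾R⁻¹≋E)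

    pullback-saturated : {Y : FRel A A} → F ⨾ (R ⁻¹ ⨾ Y ⨾ R) ⨾ F ≋ R ⁻¹ ⨾ Y ⨾ R
    pullback-saturated = ≋-trans ⨾-sandwich (⨾-cong (⨾-cong F⨾R⁻¹≋R⁻¹ ≋-refl) R⨾F≋R)

    quotients-agree⇔ : (V : FRel A A) (W : FRel B B) →
                       (∀ a₁ a₂ → (E ⨾ V ⨾ E) a₁ a₂ ≡ (F ⨾ W ⨾ F) (ψ a₁) (ψ a₂))
                       ⇔ (R ⁻¹ ⨾ V ⨾ R ≋ F ⨾ W ⨾ F)
    quotients-agree⇔ V W = mk⇔ quotients⇒pullback pullback⇒quotients
      where
        conjugate-FWF : ∀ a₁ a₂ → (R ⨾ (F ⨾ W ⨾ F) ⨾ R ⁻¹) a₁ a₂ ≡ (F ⨾ W ⨾ F) (ψ a₁) (ψ a₂)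
        conjugate-FWF a₁ a₂ = trans (conjugate (F ⨾ W ⨾ F) a₁ a₂) (≋⇒≡ F.saturate-idem (ψ a₁) (ψ a₂))

        quotients⇒pullback : (∀ a₁ a₂ → (E ⨾ V ⨾ E) a₁ a₂ ≡ (F ⨾ W ⨾ F) (ψ a₁) (ψ a₂)) →
                             R ⁻¹ ⨾ V ⨾ R ≋ F ⨾ W ⨾ F
        quotients⇒pullback agree = begin-equality
          R ⁻¹ ⨾ V ⨾ R                                    ≈⟨ pullback-saturated ⟨
          F ⨾ (R ⁻¹ ⨾ V ⨾ R) ⨾ F                          ≈⟨ F-sandwich ⟨
          R ⁻¹ ⨾ (R ⨾ (R ⁻¹ ⨾ V ⨾ R) ⨾ R ⁻¹) ⨾ R          ≈⟨ ⨾-cong-middle E-sandwich ⟩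
          R ⁻¹ ⨾ (E ⨾ V ⨾ E) ⨾ R                          ≈⟨ ⨾-cong-middle EVE≋RNR⁻¹ ⟩
          R ⁻¹ ⨾ (R ⨾ (F ⨾ W ⨾ F) ⨾ R ⁻¹) ⨾ R             ≈⟨ F-sandwich ⟩
          F ⨾ (F ⨾ W ⨾ F) ⨾ F                             ≈⟨ F.saturate-idem ⟩
          F ⨾ W ⨾ F                                       ∎
          where
            open ⊆-Reasoning
            EVE≋RNR⁻¹ : E ⨾ V ⨾ E ≋ R ⨾ (F ⨾ W ⨾ F) ⨾ R ⁻¹
            EVE≋RNR⁻¹ = ≡⇒≋ λ a₁ a₂ → trans (agree a₁ a₂) (sym (conjugate-FWF a₁ a₂))

        pullback⇒quotients : R ⁻¹ ⨾ V ⨾ R ≋ F ⨾ W ⨾ F →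
                             ∀ a₁ a₂ → (E ⨾ V ⨾ E) a₁ a₂ ≡ (F ⨾ W ⨾ F) (ψ a₁) (ψ a₂)
        pullback⇒quotients pullback a₁ a₂ = begin
          (E ⨾ V ⨾ E) a₁ a₂                        ≡⟨ ≋⇒≡ (E-sandwich {Y = V}) a₁ a₂ ⟨
          (R ⨾ (R ⁻¹ ⨾ V ⨾ R) ⨾ R ⁻¹) a₁ a₂         ≡⟨ ≋⇒≡ (⨾-cong-middle {P = R} {T = R ⁻¹} pullback) a₁ a₂ ⟩
          (R ⨾ (F ⨾ W ⨾ F) ⨾ R ⁻¹) a₁ a₂            ≡⟨ conjugate-FWF a₁ a₂ ⟩
          (F ⨾ W ⨾ F) (ψ a₁) (ψ a₂)                 ∎
          where open ≡-Reasoning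

    module Intertwining {V : FRel A A} {W : FRel B B}
                        (R⁻¹V⊆WR⁻¹ : R ⁻¹ ⨾ V ⊆ W ⨾ R ⁻¹) (RW⊆VR : R ⨾ W ⊆ V ⨾ R) where
      E-commutes : E ⨾ V ⊆ V ⨾ E
      E-commutes = begin
        E ⨾ V            ≈⟨ ⨾-cong R⨾R⁻¹≋E ≋-refl ⟨
        R ⨾ R ⁻¹ ⨾ V     ≤⟨ composite-commutes R⁻¹V⊆WR⁻¹ RW⊆VR ⟩
        V ⨾ (R ⨾ R ⁻¹)   ≈⟨ ⨾-cong ≋-refl R⨾R⁻¹≋E ⟩
        V ⨾ E            ∎
        where open ⊆-Reasoning

      F-commutes : F ⨾ W ⊆ W ⨾ F
      F-commutes = begin
        F ⨾ W            ≈⟨ ⨾-cong R⁻¹⨾R≋F ≋-refl ⟨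
        R ⁻¹ ⨾ R ⨾ W     ≤⟨ composite-commutes RW⊆VR R⁻¹V⊆WR⁻¹ ⟩
        W ⨾ (R ⁻¹ ⨾ R)   ≈⟨ ⨾-cong ≋-refl R⁻¹⨾R≋F ⟩
        W ⨾ F            ∎
        where open ⊆-Reasoning

      pullback : R ⁻¹ ⨾ V ⨾ R ≋ F ⨾ W ⨾ F
      pullback = pullback⊆ , ⊆pullback
        where
          open ⊆-Reasoning
          pullback⊆ : R ⁻¹ ⨾ V ⨾ R ⊆ F ⨾ W ⨾ F
          pullback⊆ = begin
            R ⁻¹ ⨾ V ⨾ R       ≤⟨ ⨾-mono R⁻¹V⊆WR⁻¹ ⊆-refl ⟩
            W ⨾ R ⁻¹ ⨾ R       ≈⟨ ⨾-assoc ⟩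
            W ⨾ (R ⁻¹ ⨾ R)     ≈⟨ ⨾-cong ≋-refl R⁻¹⨾R≋F ⟩
            W ⨾ F              ≤⟨ F.⊆E⨾ ⟩
            F ⨾ (W ⨾ F)        ≈⟨ ⨾-assoc ⟨
            F ⨾ W ⨾ F          ∎
          ⊆pullback : F ⨾ W ⨾ F ⊆ R ⁻¹ ⨾ V ⨾ R
          ⊆pullback = begin
            F ⨾ W ⨾ F          ≈⟨ ⨾-cong (⨾-cong R⁻¹⨾R≋F ≋-refl) ≋-refl ⟨
            R ⁻¹ ⨾ R ⨾ W ⨾ F   ≈⟨ ⨾-cong ⨾-assoc ≋-refl ⟩
            R ⁻¹ ⨾ (R ⨾ W) ⨾ F ≤⟨ ⨾-mono (⨾-mono ⊆-refl RW⊆VR) ⊆-refl ⟩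
            R ⁻¹ ⨾ (V ⨾ R) ⨾ F ≈⟨ ⨾-cong (≋-sym ⨾-assoc) ≋-refl ⟩
            R ⁻¹ ⨾ V ⨾ R ⨾ F   ≈⟨ ⨾-assoc ⟩
            R ⁻¹ ⨾ V ⨾ (R ⨾ F) ≈⟨ ⨾-cong ≋-refl R⨾F≋R ⟩
            R ⁻¹ ⨾ V ⨾ R       ∎

    module Recovery {V : FRel A A} {W : FRel B B}
                    (EV⊆VE : E ⨾ V ⊆ V ⨾ E) (FW⊆WF : F ⨾ W ⊆ W ⨾ F)
                    (pullback : R ⁻¹ ⨾ V ⨾ R ≋ F ⨾ W ⨾ F) where
      open ⊆-Reasoning

      R⁻¹V⊆WR⁻¹ : R ⁻¹ ⨾ V ⊆ W ⨾ R ⁻¹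
      R⁻¹V⊆WR⁻¹ = begin
        R ⁻¹ ⨾ V                ≤⟨ E.⊆⨾E ⟩
        R ⁻¹ ⨾ V ⨾ E            ≈⟨ ⨾-cong ≋-refl R⨾R⁻¹≋E ⟨
        R ⁻¹ ⨾ V ⨾ (R ⨾ R ⁻¹)   ≈⟨ ⨾-assoc ⟨
        R ⁻¹ ⨾ V ⨾ R ⨾ R ⁻¹     ≈⟨ ⨾-cong pullback ≋-refl ⟩
        F ⨾ W ⨾ F ⨾ R ⁻¹        ≤⟨ ⨾-mono (F.commuting⇒absorbs FW⊆WF) ⊆-refl ⟩
        W ⨾ F ⨾ R ⁻¹            ≈⟨ ⨾-assoc ⟩
        W ⨾ (F ⨾ R ⁻¹)          ≈⟨ ⨾-cong ≋-refl F⨾R⁻¹≋R⁻¹ ⟩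
        W ⨾ R ⁻¹                ∎

      RW⊆VR : R ⨾ W ⊆ V ⨾ R
      RW⊆VR = begin
        R ⨾ W                   ≈⟨ ⨾-cong R⨾F≋R ≋-refl ⟨
        R ⨾ F ⨾ W               ≈⟨ ⨾-assoc ⟩
        R ⨾ (F ⨾ W)             ≤⟨ ⨾-mono ⊆-refl F.⊆⨾E ⟩
        R ⨾ (F ⨾ W ⨾ F)         ≈⟨ ⨾-cong ≋-refl pullback ⟨
        R ⨾ (R ⁻¹ ⨾ V ⨾ R)      ≈⟨ ≋-sym ⨾-assoc ⟩
        R ⨾ (R ⁻¹ ⨾ V) ⨾ R      ≈⟨ ⨾-cong (≋-sym ⨾-assoc) ≋-refl ⟩
        R ⨾ R ⁻¹ ⨾ V ⨾ R        ≈⟨ ⨾-cong (⨾-cong R⨾R⁻¹≋E ≋-refl) ≋-refl ⟩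
        E ⨾ V ⨾ R               ≤⟨ ⨾-mono EV⊆VE ⊆-refl ⟩
        V ⨾ E ⨾ R               ≈⟨ ⨾-assoc ⟩
        V ⨾ (E ⨾ R)             ≈⟨ ⨾-cong ≋-refl E⨾R≋R ⟩
        V ⨾ R                   ∎

    WL23⇒quotient-iso : {I : Set ℓ} {V : I → FRel A A} {W : I → FRel B B} {Z : FRel A B} →
                        WL23 V W Z R →
                        WL14 V (Z ⨾ Z ⁻¹) E × WL14 W (Z ⁻¹ ⨾ Z) F × IsQuotIso E F V W R̃
    WL23⇒quotient-iso {V = V} {W} {Z} (R⁻¹V⊆WR⁻¹ , RW⊆VR , R⊆Z) =
        E.commuting⇒WL14 Iᵢ.E-commutes (⊆-trans (proj₂ R⨾R⁻¹≋E) (⨾-mono R⊆Z R⁻¹⊆Z⁻¹))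
      , F.commuting⇒WL14 Iᵢ.F-commutes (⊆-trans (proj₂ R⁻¹⨾R≋F) (⨾-mono R⁻¹⊆Z⁻¹ R⊆Z))
      , R~-isQuotIso V W (λ i → from (quotients-agree⇔ (V i) (W i)) (Iᵢ.pullback i))
      where
        module Iᵢ i = Intertwining (R⁻¹V⊆WR⁻¹ i) (RW⊆VR i)
        R⁻¹⊆Z⁻¹ : R ⁻¹ ⊆ Z ⁻¹
        R⁻¹⊆Z⁻¹ b a = R⊆Z a b

    quotient-iso⇒WL23 : {I : Set ℓ} {V : I → FRel A A} {W : I → FRel B B} {Z : FRel A B} → R ⊆ Z →
                        WL14 V (Z ⨾ Z ⁻¹) E × WL14 W (Z ⁻¹ ⨾ Z) F × IsQuotIso E F V W R̃ →
                        WL23 V W Z R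
    quotient-iso⇒WL23 {V = V} {W} R⊆Z ((EV⊆VE , _) , (FW⊆WF , _) , iso) =
      Rᵢ.R⁻¹V⊆WR⁻¹ , Rᵢ.RW⊆VR , R⊆Z
      where
        preserves : ∀ i a₁ a₂ → (E ⨾ V i ⨾ E) a₁ a₂ ≡ (F ⨾ W i ⨾ F) (ψ a₁) (ψ a₂)
        preserves i a₁ a₂ = IsQuotIso.preserves iso i ([ E ] a₁) ([ E ] a₂)
        module Rᵢ i = Recovery (EV⊆VE i) (FW⊆WF i) (to (quotients-agree⇔ (V i) (W i)) (preserves i))

theorem7p2 : {c ℓ : Level} (L : CRL c ℓ) → let open FuzzyRel L in
    (A B I : Set ℓ) → A → B → I →
    (V : I → FRel A A) (W : I → FRel B B)
    (R Z : FRel A B) (u : IsUniform R) → R ⊆ Z →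
    WL23 V W Z R ⇔
    ( WL14 V (Z ⨾ Z ⁻¹) (kerA R)
    × WL14 W (Z ⁻¹ ⨾ Z) (kerB R)
    × IsQuotIso (kerA R) (kerB R) V W (R~ R u) )
theorem7p2 L A B I _ _ _ V W R Z u R⊆Z = mk⇔ WL23⇒quotient-iso (quotient-iso⇒WL23 R⊆Z)
  where open FuzzyRelationCalculus.Uniform L R u
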